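{- For $n\geq 4$, the number of minimal forts for $P_{n}$ satisfies \[ \lvert\mathcal{F}_{P_{n}}\rvert = \lvert\mathcal{F}_{P_{n-2}}\rvert + \lvert\mathcal{F}_{P_{n-3}}\rvert, \] where $\lvert\mathcal{F}_{P_{1}}\rvert=1$, $\lvert\mathcal{F}_{P_{2}}\rvert=1$, and $\lvert\mathcal{F}_{P_{3}}\rvert=1$.
   Context: For a graph $G=(V,E)$, a non-empty subset $F\subseteq V$ is a fort if no vertex outside $F$ has exactly one neighbor in $F$; a fort is minimal if every proper subset is not a fort. $\mathcal{F}_{G}$ denotes the collection of all minimal forts of $G$. $P_{n}$ is the path graph with vertices $v_1,\ldots,v_n$ and edges $\{v_i,v_{i+1}\}$, $i=1,\ldots,n-1$. -}

module Defs where

open import Data.Nat using (ℕ; suc; _+_)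
open import Data.Fin using (Fin; toℕ)
open import Data.Fin.Subset using (Subset; _∈_; _∉_; _⊂_; _∩_; ∣_∣; Nonempty)
open import Data.Vec using (tabulate)
open import Data.List using (List; length)
open import Data.List.Membership.Propositional using () renaming (_∈_ to _∈ₗ_)
open import Data.List.Relation.Unary.Unique.Propositional using (Unique)
open import Data.Product using (Σ; _×_)
open import Data.Sum using (_⊎_)
open import Relation.Nullary using (¬_)
open import Relation.Nullary.Decidable using (⌊_⌋)
open import Relation.Binary.PropositionalEquality using (_≡_; _≢_)
open import Function.Bundles using (_⇔_)
import Data.Nat as ℕ

-- Path graph P_n on vertices Fin n (vertex v_{i+1} is i : Fin n),
-- edges {i , i+1}: i and j adjacent iff toℕ j = toℕ i + 1 or vice versa.
-- Neighbourhood of v in P_n, as a subset.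
pathNbrs : ∀ {n} → Fin n → Subset n
pathNbrs i = tabulate (λ j → ⌊ suc (toℕ i) ℕ.≟ toℕ j ⌋ Data.Bool.∨ ⌊ suc (toℕ j) ℕ.≟ toℕ i ⌋)
  where import Data.Bool

IsFort : ∀ n → Subset n → Set
IsFort n F = Nonempty F × (∀ (v : Fin n) → v ∉ F → ∣ pathNbrs v ∩ F ∣ ≢ 1)

IsMinimalFort : ∀ n → Subset n → Set
IsMinimalFort n F = IsFort n F × (∀ G → G ⊂ F → ¬ IsFort n G)

-- |F_{P_n}| = k : the collection of minimal forts of P_n is listed
-- exactly (without repetition) by a list of length k.
NumMinimalForts : ℕ → ℕ → Set
NumMinimalForts n k =
  Σ (List (Subset n)) λ L →
    Unique L × (∀ F → (F ∈ₗ L) ⇔ IsMinimalFort n F) × (length L ≡ k)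

{-# OPTIONS --safe #-}
module Submission where

-- Read a subset of P_n as a word over {inside, outside}.  It is a fort iff it is non-empty
-- and each outside letter has equal neighbours (the ends of the path counting as outside);
-- so a fort starts and ends inside and never has two adjacent outside letters.  Thinning
-- every run 111 to 101 turns a fort into a word made of blocks 10 and 110 followed by
-- 1 or 11, which is still a fort, and a fort of that shape has no proper subfort.  Hence
-- the minimal forts are exactly these block words, and one of length n is 10 followed by
-- one of length n - 2 or 110 followed by one of length n - 3.

open import Defs
open import Data.Nat using (ℕ; zero; suc; _≤_; _+_; _∸_; _≡ᵇ_; s≤s)
import Data.Nat as ℕ
open import Data.Bool using (_∨_)
open import Data.Fin using (Fin; zero; suc; toℕ)
open import Data.Fin.Subset
  using (Side; inside; outside; Subset; _∉_; _⊆_; _⊂_; _∩_; ∣_∣; Nonempty)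
open import Data.Fin.Subset.Properties
  using (drop-there; drop-not-there; drop-∷-⊆; ⊆-refl; s⊆s; out⊆; s⊂s; out⊂in; ⊂-irref)
open import Data.Vec using ([]; _∷_; here; there; tabulate)
open import Data.Vec.Properties using (tabulate-cong)
open import Data.List using (List; []; _∷_; map; _++_; length)
open import Data.List.Properties using (length-++; length-map)
open import Data.List.Membership.Propositional using () renaming (_∈_ to _∈ₗ_)
open import Data.List.Membership.Propositional.Properties
  using (∈-map⁺; ∈-map⁻; ∈-++⁺ˡ; ∈-++⁺ʳ; ∈-++⁻)
open import Data.List.Relation.Unary.Any using (here)
open import Data.List.Relation.Unary.All using ([])
open import Data.List.Relation.Unary.AllPairs using ([]; _∷_)
open import Data.List.Relation.Unary.Unique.Propositional using (Unique)
open import Data.List.Relation.Unary.Unique.Propositional.Properties using (map⁺; ++⁺)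
open import Data.List.Relation.Binary.Disjoint.Propositional using (Disjoint)
open import Data.Product using (_×_; _,_; proj₁; ∃; map₂)
open import Data.Sum using (_⊎_; inj₁; inj₂)
import Data.Sum as Sum
open import Data.Unit using (⊤; tt)
open import Data.Empty using (⊥-elim)
open import Function using (_∘_)
open import Function.Bundles using (_⇔_; mk⇔; Equivalence)
import Function.Properties.Equivalence as ⇔
open import Relation.Nullary.Decidable using (isYes≗does)
open import Relation.Binary.PropositionalEquality using (_≡_; _≢_; refl; sym; trans; cong; cong₂; subst)

private
  variable
    m n a b : ℕ
    s t p : Side
    F G : Subset n

-- pathNbrs with ⌊_≟_⌋ replaced by _≡ᵇ_, which reduces on zero and suc.
adjacent : Fin n → Fin n → Side
adjacent i j = (suc (toℕ i) ≡ᵇ toℕ j) ∨ (suc (toℕ j) ≡ᵇ toℕ i)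

pathNbrs≡tabulate-adjacent : (v : Fin n) → pathNbrs v ≡ tabulate (adjacent v)
pathNbrs≡tabulate-adjacent v = tabulate-cong λ j →
  cong₂ _∨_ (isYes≗does (suc (toℕ v) ℕ.≟ toℕ j)) (isYes≗does (suc (toℕ j) ℕ.≟ toℕ v))

first : Subset n → Side
first []      = outside
first (x ∷ _) = x

-- Membership in F of v - 1 and of v + 1, outside beyond the ends; p stands for v - 1 at v = 0.
left : Side → Subset n → Fin n → Side
left p (_ ∷ F) zero    = p
left p (x ∷ F) (suc v) = left x F v

right : Subset n → Fin n → Side
right (_ ∷ F) zero    = first F
right (_ ∷ F) (suc v) = right F v

∣outside∩∣≡0 : (F : Subset n) → ∣ tabulate (λ _ → outside) ∩ F ∣ ≡ 0
∣outside∩∣≡0 []      = refl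
∣outside∩∣≡0 (_ ∷ F) = ∣outside∩∣≡0 F

∣s∷outside∩∣ : ∀ s (F : Subset n) → ∣ s ∷ (tabulate (λ _ → outside) ∩ F) ∣ ≡ ∣ s ∷ [] ∣
∣s∷outside∩∣ inside  F = cong suc (∣outside∩∣≡0 F)
∣s∷outside∩∣ outside F = ∣outside∩∣≡0 F

∣adjacent∩∣ : (F : Subset n) (v : Fin n) →
              ∣ tabulate (adjacent v) ∩ F ∣ ≡ ∣ left outside F v ∷ right F v ∷ [] ∣
∣adjacent∩∣ (_ ∷ [])              zero          = refl
∣adjacent∩∣ (_ ∷ y ∷ F)           zero          = ∣s∷outside∩∣ y F
∣adjacent∩∣ (_ ∷ [])              (suc ())
∣adjacent∩∣ (_ ∷ _ ∷ [])          (suc zero)    = refl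
∣adjacent∩∣ (inside ∷ _ ∷ z ∷ F)  (suc zero)    = cong suc (∣s∷outside∩∣ z F)
∣adjacent∩∣ (outside ∷ _ ∷ z ∷ F) (suc zero)    = ∣s∷outside∩∣ z F
∣adjacent∩∣ (_ ∷ y ∷ F)           (suc (suc v)) = ∣adjacent∩∣ (y ∷ F) (suc v)

∣pathNbrs∩∣ : (F : Subset n) (v : Fin n) →
              ∣ pathNbrs v ∩ F ∣ ≡ ∣ left outside F v ∷ right F v ∷ [] ∣
∣pathNbrs∩∣ F v = trans (cong (λ N → ∣ N ∩ F ∣) (pathNbrs≡tabulate-adjacent v)) (∣adjacent∩∣ F v)

∣s∷t∣≢1⇔s≡t : ∣ s ∷ t ∷ [] ∣ ≢ 1 ⇔ s ≡ t
∣s∷t∣≢1⇔s≡t = mk⇔ to from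
  where
  to : ∣ s ∷ t ∷ [] ∣ ≢ 1 → s ≡ t
  to {inside}  {inside}  _ = refl
  to {outside} {outside} _ = refl
  to {inside}  {outside} ≢1 = ⊥-elim (≢1 refl)
  to {outside} {inside}  ≢1 = ⊥-elim (≢1 refl)
  from : s ≡ t → ∣ s ∷ t ∷ [] ∣ ≢ 1
  from {inside}  refl ()
  from {outside} refl ()

-- p is the letter just before F.
Balanced : Side → Subset n → Set
Balanced p []      = ⊤
Balanced p (x ∷ F) = (x ≡ outside → p ≡ first F) × Balanced x F

balanced⇔ : Balanced p F ⇔ (∀ v → v ∉ F → left p F v ≡ right F v)
balanced⇔ = mk⇔ to from
  where
  to : Balanced p F → ∀ v → v ∉ F → left p F v ≡ right F v
  to {F = inside  ∷ _} _               zero    0∉F = ⊥-elim (0∉F here)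
  to {F = outside ∷ _} (balanced₀ , _) zero    _   = balanced₀ refl
  to {F = _ ∷ _}       (_ , balanced)  (suc v) v∉F = to balanced v (drop-not-there v∉F)
  from : (∀ v → v ∉ F → left p F v ≡ right F v) → Balanced p F
  from {F = []}    _        = tt
  from {F = _ ∷ _} balanced =
    (λ { refl → balanced zero λ () }) , from (λ v v∉F → balanced (suc v) (v∉F ∘ drop-there))

∣pathNbrs∩∣≢1⇔ : (F : Subset n) (v : Fin n) →
                 ∣ pathNbrs v ∩ F ∣ ≢ 1 ⇔ left outside F v ≡ right F v
∣pathNbrs∩∣≢1⇔ F v =
  subst (λ k → k ≢ 1 ⇔ left outside F v ≡ right F v) (sym (∣pathNbrs∩∣ F v)) ∣s∷t∣≢1⇔s≡t

isFort⇔nonempty×balanced : IsFort n F ⇔ (Nonempty F × Balanced outside F)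
isFort⇔nonempty×balanced {F = F} = mk⇔
  (map₂ λ fort → Equivalence.from balanced⇔ λ v v∉F →
     Equivalence.to (∣pathNbrs∩∣≢1⇔ F v) (fort v v∉F))
  (map₂ λ balanced v v∉F →
     Equivalence.from (∣pathNbrs∩∣≢1⇔ F v) (Equivalence.to balanced⇔ balanced v v∉F))

prefix10 : Subset n → Subset (2 + n)
prefix10 F = inside ∷ outside ∷ F

prefix110 : Subset n → Subset (3 + n)
prefix110 F = inside ∷ inside ∷ outside ∷ F

data MinFortShape : Subset n → Set where
  ⟨1⟩     : MinFortShape (inside ∷ [])
  ⟨11⟩    : MinFortShape (inside ∷ inside ∷ [])
  ⟨10⟩∷_  : MinFortShape F → MinFortShape (prefix10 F)
  ⟨110⟩∷_ : MinFortShape F → MinFortShape (prefix110 F)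

first-shape : MinFortShape F → first F ≡ inside
first-shape ⟨1⟩        = refl
first-shape ⟨11⟩       = refl
first-shape (⟨10⟩∷ _)  = refl
first-shape (⟨110⟩∷ _) = refl

first≡inside⇒nonempty : first F ≡ inside → Nonempty F
first≡inside⇒nonempty {F = inside ∷ _} refl = zero , here

shape⇒balanced : MinFortShape F → Balanced p F
shape⇒balanced ⟨1⟩        = (λ ()) , tt
shape⇒balanced ⟨11⟩       = (λ ()) , (λ ()) , tt
shape⇒balanced (⟨10⟩∷ s)  = (λ ()) , (λ _ → sym (first-shape s)) , shape⇒balanced s
shape⇒balanced (⟨110⟩∷ s) = (λ ()) , (λ ()) , (λ _ → sym (first-shape s)) , shape⇒balanced s

balanced-nonempty⇒first : Balanced outside F → Nonempty F → first F ≡ inside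
balanced-nonempty⇒first {F = inside ∷ _}  _                     _               = refl
balanced-nonempty⇒first {F = outside ∷ _} (balanced₀ , balanced) (suc v , there v∈F)
  with () ← trans (balanced₀ refl) (balanced-nonempty⇒first balanced (v , v∈F))

shape⇒fort : MinFortShape F → IsFort n F
shape⇒fort s = Equivalence.from isFort⇔nonempty×balanced
  (first≡inside⇒nonempty (first-shape s) , shape⇒balanced s)

shape-rigid : MinFortShape F → G ⊆ F → Balanced outside G → first G ≡ inside → G ≡ F
shape-rigid {G = outside ∷ _} _ _ _ ()
shape-rigid {G = inside ∷ []}          ⟨1⟩  _ _ _ = refl
shape-rigid {G = inside ∷ inside ∷ []}  ⟨11⟩ _ _ _ = refl
shape-rigid {G = inside ∷ outside ∷ []} ⟨11⟩ _ (_ , balanced₁ , _) _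
  with () ← balanced₁ refl
shape-rigid {G = inside ∷ inside ∷ _} (⟨10⟩∷ _) G⊆F _ _
  with there () ← G⊆F (there here)
shape-rigid {G = inside ∷ outside ∷ _} (⟨10⟩∷ s) G⊆F (_ , balanced₁ , balanced) _ =
  cong prefix10 (shape-rigid s (drop-∷-⊆ (drop-∷-⊆ G⊆F)) balanced (sym (balanced₁ refl)))
shape-rigid {G = inside ∷ _ ∷ inside ∷ _} (⟨110⟩∷ _) G⊆F _ _
  with there (there ()) ← G⊆F (there (there here))
shape-rigid {G = inside ∷ outside ∷ outside ∷ _} (⟨110⟩∷ _) _ (_ , balanced₁ , _) _
  with () ← balanced₁ refl
shape-rigid {G = inside ∷ inside ∷ outside ∷ _} (⟨110⟩∷ s) G⊆F (_ , _ , balanced₂ , balanced) _ =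
  cong prefix110 (shape-rigid s (drop-∷-⊆ (drop-∷-⊆ (drop-∷-⊆ G⊆F))) balanced (sym (balanced₂ refl)))

-- Each run 111 is thinned to 101.
balanced⇒shape⊆ : (X : Subset n) → Balanced inside X → ∃ λ M → MinFortShape M × M ⊆ inside ∷ X
balanced⇒shape⊆ []                  _ = _ , ⟨1⟩ , ⊆-refl
balanced⇒shape⊆ (inside ∷ [])       _ = _ , ⟨11⟩ , ⊆-refl
balanced⇒shape⊆ (outside ∷ [])      (balanced₀ , _) with () ← balanced₀ refl
balanced⇒shape⊆ (outside ∷ outside ∷ _) (balanced₀ , _) with () ← balanced₀ refl
balanced⇒shape⊆ (outside ∷ inside ∷ X) (_ , _ , balanced) =
  let M , s , M⊆X = balanced⇒shape⊆ X balanced in prefix10 M , ⟨10⟩∷ s , s⊆s (s⊆s M⊆X)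
balanced⇒shape⊆ (inside ∷ inside ∷ X) (_ , _ , balanced) =
  let M , s , M⊆X = balanced⇒shape⊆ X balanced in prefix10 M , ⟨10⟩∷ s , s⊆s (out⊆ M⊆X)
balanced⇒shape⊆ (inside ∷ outside ∷ []) (_ , balanced₁ , _) with () ← balanced₁ refl
balanced⇒shape⊆ (inside ∷ outside ∷ outside ∷ _) (_ , balanced₁ , _) with () ← balanced₁ refl
balanced⇒shape⊆ (inside ∷ outside ∷ inside ∷ X) (_ , _ , _ , balanced) =
  let M , s , M⊆X = balanced⇒shape⊆ X balanced in prefix110 M , ⟨110⟩∷ s , s⊆s (s⊆s (s⊆s M⊆X))

⊆⇒≡⊎⊂ : G ⊆ F → G ≡ F ⊎ G ⊂ F
⊆⇒≡⊎⊂ {G = []}          {[]}          _    = inj₁ refl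
⊆⇒≡⊎⊂ {G = inside ∷ _}  {outside ∷ _} G⊆F with () ← G⊆F here
⊆⇒≡⊎⊂ {G = outside ∷ _} {inside ∷ _}  G⊆F = inj₂ (out⊂in (drop-∷-⊆ G⊆F))
⊆⇒≡⊎⊂ {G = inside ∷ _}  {inside ∷ _}  G⊆F = Sum.map (cong (inside ∷_)) s⊂s (⊆⇒≡⊎⊂ (drop-∷-⊆ G⊆F))
⊆⇒≡⊎⊂ {G = outside ∷ _} {outside ∷ _} G⊆F = Sum.map (cong (outside ∷_)) s⊂s (⊆⇒≡⊎⊂ (drop-∷-⊆ G⊆F))

fort⇒shape⊆ : IsFort n F → ∃ λ M → MinFortShape M × M ⊆ F
fort⇒shape⊆ fort with Equivalence.to isFort⇔nonempty×balanced fort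
... | nonempty , balanced with balanced-nonempty⇒first balanced nonempty
fort⇒shape⊆ {F = inside ∷ X} _ | _ , (_ , balanced) | refl = balanced⇒shape⊆ X balanced

minimalFort⇔shape : IsMinimalFort n F ⇔ MinFortShape F
minimalFort⇔shape = mk⇔ to from
  where
  to : IsMinimalFort n F → MinFortShape F
  to (fort , minimal) with fort⇒shape⊆ fort
  ... | M , s , M⊆F with ⊆⇒≡⊎⊂ M⊆F
  ...   | inj₁ refl = s
  ...   | inj₂ M⊂F  = ⊥-elim (minimal M M⊂F (shape⇒fort s))
  from : MinFortShape F → IsMinimalFort n F
  from s = shape⇒fort s , λ G G⊂F fortG →
    let nonempty , balanced = Equivalence.to isFort⇔nonempty×balanced fortG
    in ⊂-irref (shape-rigid s (proj₁ G⊂F) balanced (balanced-nonempty⇒first balanced nonempty)) G⊂F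

count-unique : (F₀ : Subset n) → MinFortShape F₀ → (∀ {F} → MinFortShape F → F ≡ F₀) →
               NumMinimalForts n 1
count-unique F₀ s unique = F₀ ∷ [] , [] ∷ [] , enumerates , refl
  where
  enumerates : ∀ F → F ∈ₗ F₀ ∷ [] ⇔ IsMinimalFort _ F
  enumerates F = mk⇔ (λ { (here refl) → Equivalence.from minimalFort⇔shape s })
                     (here ∘ unique ∘ Equivalence.to minimalFort⇔shape)

module _ (L₁ : List (Subset (suc m))) (L₂ : List (Subset m)) where

  prefixed : List (Subset (3 + m))
  prefixed = map prefix10 L₁ ++ map prefix110 L₂

  ∈-prefixed⇔shape : (∀ F → F ∈ₗ L₁ ⇔ MinFortShape F) → (∀ F → F ∈ₗ L₂ ⇔ MinFortShape F) →
                     ∀ F → F ∈ₗ prefixed ⇔ MinFortShape F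
  ∈-prefixed⇔shape enum₁ enum₂ F = mk⇔ to from
    where
    to : F ∈ₗ prefixed → MinFortShape F
    to F∈ with ∈-++⁻ (map prefix10 L₁) F∈
    ... | inj₁ F∈₁ with G , G∈ , refl ← ∈-map⁻ prefix10 F∈₁  = ⟨10⟩∷ Equivalence.to (enum₁ G) G∈
    ... | inj₂ F∈₂ with G , G∈ , refl ← ∈-map⁻ prefix110 F∈₂ = ⟨110⟩∷ Equivalence.to (enum₂ G) G∈
    from : MinFortShape F → F ∈ₗ prefixed
    from (⟨10⟩∷ s)  = ∈-++⁺ˡ (∈-map⁺ prefix10 (Equivalence.from (enum₁ _) s))
    from (⟨110⟩∷ s) = ∈-++⁺ʳ (map prefix10 L₁) (∈-map⁺ prefix110 (Equivalence.from (enum₂ _) s))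

  prefixed-unique : Unique L₁ → Unique L₂ → Unique prefixed
  prefixed-unique unique₁ unique₂ =
    ++⁺ (map⁺ (λ { refl → refl }) unique₁) (map⁺ (λ { refl → refl }) unique₂) disjoint
    where
    disjoint : Disjoint (map prefix10 L₁) (map prefix110 L₂)
    disjoint (F∈₁ , F∈₂) with ∈-map⁻ prefix10 F∈₁ | ∈-map⁻ prefix110 F∈₂
    ... | _ , _ , refl | _ , _ , ()

  length-prefixed : length prefixed ≡ length L₁ + length L₂
  length-prefixed = trans (length-++ (map prefix10 L₁))
                          (cong₂ _+_ (length-map prefix10 L₁) (length-map prefix110 L₂))

count-recurrence : NumMinimalForts (suc m) a → NumMinimalForts m b →
                   NumMinimalForts (3 + m) (a + b)
count-recurrence (L₁ , unique₁ , enum₁ , refl) (L₂ , unique₂ , enum₂ , refl) =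
  prefixed L₁ L₂ , prefixed-unique L₁ L₂ unique₁ unique₂ , enumerates , length-prefixed L₁ L₂
  where
  viaShapes : ∀ {k} {L : List (Subset k)} →
              (∀ F → F ∈ₗ L ⇔ IsMinimalFort k F) → ∀ F → F ∈ₗ L ⇔ MinFortShape F
  viaShapes enum F = ⇔.trans (enum F) minimalFort⇔shape
  enumerates : ∀ F → F ∈ₗ prefixed L₁ L₂ ⇔ IsMinimalFort _ F
  enumerates F = ⇔.trans (∈-prefixed⇔shape L₁ L₂ (viaShapes enum₁) (viaShapes enum₂) F)
                         (⇔.sym minimalFort⇔shape)

corollary4p6 : (NumMinimalForts 1 1 × NumMinimalForts 2 1 × NumMinimalForts 3 1)
    × (∀ (n a b : ℕ) → 4 ≤ n → NumMinimalForts (n ∸ 2) a → NumMinimalForts (n ∸ 3) b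
    → NumMinimalForts n (a + b))
corollary4p6 =
  ( count-unique _ ⟨1⟩ (λ { ⟨1⟩ → refl })
  , count-unique _ ⟨11⟩ (λ { ⟨11⟩ → refl })
  , count-unique _ (⟨10⟩∷ ⟨1⟩) (λ { (⟨10⟩∷ ⟨1⟩) → refl ; (⟨110⟩∷ ()) }) )
  , recurrence
  where
  recurrence : ∀ n a b → 4 ≤ n → NumMinimalForts (n ∸ 2) a → NumMinimalForts (n ∸ 3) b →
               NumMinimalForts n (a + b)
  recurrence _ _ _ (s≤s (s≤s (s≤s _))) = count-recurrence
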